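{- Let $D$ be a strongly connected digraph with girth $g$, and let $T$ be a DFS tree of $D$ rooted at $r$, of length $t$, with generations $V_0,\ldots,V_t$. Then for each integer $h$ with $0\leq h\leq t-g+2$, the set $W_h=\bigcup_{i=0}^{g-2}V_{h+i}$ induces an acyclic subdigraph of $D$. Moreover, there is no backward arc with both ends in $W_h$.
   Context: All digraphs are finite and loopless. Strongly connected: directed path between any ordered pair of distinct vertices. Girth: length of a shortest directed cycle. A DFS tree $T$ of $D$ rooted at $r$ is the spanning out-branching produced by depth-first search on $D$ from $r$. $v$ is a descendant of $u$ if there is a directed $uv$-path in $T$; an arc $(u,v)$ of $D$ is a backward arc (relative to $T$) if $u$ is a descendant of $v$. $P_u$ is the unique directed path in $T$ from $r$ to $u$, $l(P_u)$ its number of arcs; the length of $T$ is $t=\max_u l(P_u)$ and $V_i=\{u: l(P_u)=i\}$. A digraph is acyclic if it contains no directed cycle. -}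

module Defs where

open import Data.Nat using (ℕ; zero; suc; _+_; _≤_)
open import Data.Fin using (Fin; fromℕ; inject₁) renaming (zero to fzero; suc to fsuc)
open import Data.List using (List; []; _∷_)
open import Data.List.Membership.Propositional using (_∈_; _∉_)
open import Data.Product using (Σ; ∃; _×_; _,_)
open import Relation.Nullary using (¬_)
open import Relation.Binary.PropositionalEquality using (_≡_; _≢_)
open import Relation.Binary.Construct.Closure.ReflexiveTransitive using (Star)
open import Function.Definitions using (Injective)

record Digraph (n : ℕ) : Set₁ where
  field
    Arc      : Fin n → Fin n → Set
    loopless : ∀ v → ¬ Arc v v
open Digraph public

module _ {n : ℕ} (D : Digraph n) where

  Reach : Fin n → Fin n → Set
  Reach = Star (Arc D)

  StronglyConnected : Set
  StronglyConnected = ∀ u v → u ≢ v → Reach u v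

  -- a directed cycle of length (suc k): distinct vertices c 0, …, c k
  -- with arcs c i → c (i+1) and c k → c 0
  record Cycle (k : ℕ) : Set where
    field
      vtx      : Fin (suc k) → Fin n
      distinct : Injective _≡_ _≡_ vtx
      step     : ∀ (i : Fin k) → Arc D (vtx (inject₁ i)) (vtx (fsuc i))
      close    : Arc D (vtx (fromℕ k)) (vtx fzero)

  HasGirth : ℕ → Set
  HasGirth g = (Σ ℕ λ k → suc k ≡ g × Cycle k) × (∀ k → Cycle k → g ≤ suc k)

  InducedAcyclic : (Fin n → Set) → Set
  InducedAcyclic W = ∀ k (C : Cycle k) → ¬ (∀ i → W (Cycle.vtx C i))

  -- Depth-first search, modelled nondeterministically (any choice of the
  -- next unvisited out-neighbour is allowed).
  record DFSState : Set where
    constructor ⟨_,_,_⟩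
    field
      stack   : List (Fin n)
      visited : List (Fin n)
      tree    : List (Fin n × Fin n)

  data DFSStep : DFSState → DFSState → Set where
    push : ∀ {u s vis T v} → Arc D u v → v ∉ vis →
           DFSStep ⟨ u ∷ s , vis , T ⟩ ⟨ v ∷ u ∷ s , v ∷ vis , (u , v) ∷ T ⟩
    pop  : ∀ {u s vis T} → (∀ v → Arc D u v → v ∈ vis) →
           DFSStep ⟨ u ∷ s , vis , T ⟩ ⟨ s , vis , T ⟩

  IsDFSTree : Fin n → List (Fin n × Fin n) → Set
  IsDFSTree r T = ∃ λ vis → Star DFSStep ⟨ r ∷ [] , r ∷ [] , [] ⟩ ⟨ [] , vis , T ⟩

module _ {n : ℕ} (T : List (Fin n × Fin n)) (r : Fin n) where

  TArc : Fin n → Fin n → Set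
  TArc u v = (u , v) ∈ T

  Descendant : Fin n → Fin n → Set
  Descendant v u = Star TArc u v

  data Depth : Fin n → ℕ → Set where
    root : Depth r 0
    child : ∀ {p u i} → TArc p u → Depth p i → Depth u (suc i)

  Gen : ℕ → Fin n → Set
  Gen i u = Depth u i

  HasLength : ℕ → Set
  HasLength t = (∀ u i → Depth u i → i ≤ t) × (∃ λ u → Depth u t)

  W : ℕ → ℕ → Fin n → Set
  W g h u = Σ ℕ λ i → (i + 2 ≤ g) × Gen (h + i) u

module Submission where

-- Order the reached vertices by DFS finishing time. An arc leaving a finished vertex ends
-- at a vertex finished earlier or at one still on the stack, which is an ancestor; so every
-- arc out of the tree either decreases the finishing time or is backward. A backward arc
-- u → v closes the tree path from v to u into a cycle, so u and v are at least g − 1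
-- generations apart and cannot both lie in W_h. Inside W_h the finishing time therefore
-- strictly decreases along arcs, and W_h is acyclic.

open import Defs
open import Data.Nat using (ℕ; zero; suc; _+_; _≤_; _<_; s≤s)
open import Data.Nat.Properties
  using (≤-refl; ≤-trans; <⇒≤; <-≤-trans; <-irrefl; m<n⇒m<1+n; +-comm; +-suc; +-cancelʳ-≡;
         +-monoʳ-≤; +-cancelʳ-≤; m≤m+n; module ≤-Reasoning)
open import Data.Fin using (Fin; toℕ; fromℕ; inject₁) renaming (zero to fzero; suc to fsuc)
open import Data.Fin.Properties using (toℕ-injective)
open import Data.List using (List; []; _∷_; length)
open import Data.List.Membership.Propositional using (_∈_; _∉_)
open import Data.List.Relation.Unary.Any using (here; there)
open import Data.List.Relation.Unary.All using (_∷_)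
import Data.List.Relation.Unary.All as All
open import Data.List.Relation.Unary.AllPairs using (AllPairs; _∷_)
import Data.List.Relation.Unary.AllPairs as AllPairs
open import Data.List.Relation.Unary.Unique.Propositional using (Unique)
open import Data.Vec.Functional using (updateAt)
open import Data.Vec.Functional.Properties using (updateAt-updates; updateAt-minimal)
open import Data.Product using (_×_; _,_; proj₁; proj₂)
open import Data.Sum using (_⊎_; inj₁; inj₂)
import Data.Sum as Sum
open import Data.Empty using (⊥-elim)
open import Function using (_∘_; const)
open import Function.Definitions using (Injective)
open import Relation.Nullary using (¬_)
open import Relation.Binary.PropositionalEquality using (_≡_; _≢_; refl; sym; cong; subst; subst₂)
open import Relation.Binary.Construct.Closure.ReflexiveTransitive using (Star; ε; _◅_; _◅◅_)
import Relation.Binary.Construct.Closure.ReflexiveTransitive as Star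

module _ {n : ℕ} {R : Fin n → Fin n → Set} where

  steps : ∀ {a b} → Star R a b → ℕ
  steps ε       = 0
  steps (_ ◅ p) = suc (steps p)

  vertexAt : ∀ {a b} (p : Star R a b) → Fin (suc (steps p)) → Fin n
  vertexAt {a} ε       fzero    = a
  vertexAt {a} (_ ◅ _) fzero    = a
  vertexAt     (_ ◅ p) (fsuc i) = vertexAt p i

  vertexAt-first : ∀ {a b} (p : Star R a b) → vertexAt p fzero ≡ a
  vertexAt-first ε       = refl
  vertexAt-first (_ ◅ _) = refl

  vertexAt-last : ∀ {a b} (p : Star R a b) → vertexAt p (fromℕ (steps p)) ≡ b
  vertexAt-last ε       = refl
  vertexAt-last (_ ◅ p) = vertexAt-last p

  vertexAt-step : ∀ {a b} (p : Star R a b) (i : Fin (steps p)) →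
                  R (vertexAt p (inject₁ i)) (vertexAt p (fsuc i))
  vertexAt-step (x ◅ p) fzero    = subst (R _) (sym (vertexAt-first p)) x
  vertexAt-step (_ ◅ p) (fsuc i) = vertexAt-step p i

  cycle-from-closed-walk : (D : Digraph n) → (∀ {x y} → R x y → Arc D x y) →
                           ∀ {a b} (p : Star R a b) → Injective _≡_ _≡_ (vertexAt p) →
                           Arc D b a → Cycle D (steps p)
  cycle-from-closed-walk D R⇒Arc p injective back = record
    { vtx      = vertexAt p
    ; distinct = injective
    ; step     = R⇒Arc ∘ vertexAt-step p
    ; close    = subst₂ (Arc D) (sym (vertexAt-last p)) (sym (vertexAt-first p)) back
    }

descending-last≤first : ∀ k (f : Fin (suc k) → ℕ) → (∀ i → f (fsuc i) < f (inject₁ i)) →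
                        f (fromℕ k) ≤ f fzero
descending-last≤first zero    f _    = ≤-refl
descending-last≤first (suc k) f desc =
  ≤-trans (descending-last≤first k (f ∘ fsuc) (desc ∘ fsuc)) (<⇒≤ (desc fzero))

acyclic-if-potential-decreases : ∀ {n} (D : Digraph n) (U : Fin n → Set) (φ : Fin n → ℕ) →
                                 (∀ {a b} → U a → U b → Arc D a b → φ b < φ a) →
                                 InducedAcyclic D U
acyclic-if-potential-decreases D U φ decreases k C inU =
  <-irrefl refl (<-≤-trans (decreases (inU _) (inU _) close)
                           (descending-last≤first k (φ ∘ vtx)
                              (λ i → decreases (inU _) (inU _) (step i))))
  where open Cycle C

module _ {n : ℕ} {T : List (Fin n × Fin n)} {r : Fin n} where

  depth-along-path : ∀ {a b k} → Depth T r a k → (p : Star (TArc T r) a b) →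
                     ∀ i → Depth T r (vertexAt p i) (toℕ i + k)
  depth-along-path d ε       fzero    = d
  depth-along-path d (_ ◅ _) fzero    = d
  depth-along-path d (x ◅ p) (fsuc i) =
    subst (Depth T r _) (+-suc (toℕ i) _) (depth-along-path (child x d) p i)

  UniqueDepths : Set
  UniqueDepths = ∀ {u i j} → Depth T r u i → Depth T r u j → i ≡ j

  depth-unique : (∀ {p x} → TArc T r p x → x ≢ r) →
                 (∀ {p q x} → TArc T r p x → TArc T r q x → p ≡ q) → UniqueDepths
  depth-unique parentless unique root        root          = refl
  depth-unique parentless unique root        (child x _)   = ⊥-elim (parentless x refl)
  depth-unique parentless unique (child x _) root          = ⊥-elim (parentless x refl)
  depth-unique parentless unique (child x d) (child y d′) with unique x y
  ... | refl = cong suc (depth-unique parentless unique d d′)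

  depth-at-end : ∀ {a b k} → Depth T r a k → (p : Star (TArc T r) a b) → Depth T r b (steps p + k)
  depth-at-end d ε       = d
  depth-at-end d (x ◅ p) = subst (Depth T r _) (+-suc (steps p) _) (depth-at-end (child x d) p)

  tree-path-injective : UniqueDepths → ∀ {a b k} → Depth T r a k → (p : Star (TArc T r) a b) →
                        Injective _≡_ _≡_ (vertexAt p)
  tree-path-injective unique d p {i} {j} same =
    toℕ-injective (+-cancelʳ-≡ _ (toℕ i) (toℕ j)
      (unique (depth-along-path d p i)
              (subst (λ x → Depth T r x _) (sym same) (depth-along-path d p j))))

m+[h+j]≡h+i⇒m≤i : ∀ m h i j → m + (h + j) ≡ h + i → m ≤ i
m+[h+j]≡h+i⇒m≤i m h i j eq = +-cancelʳ-≤ h m i (begin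
  m + h       ≤⟨ +-monoʳ-≤ m (m≤m+n h j) ⟩
  m + (h + j) ≡⟨ eq ⟩
  h + i       ≡⟨ +-comm h i ⟩
  i + h       ∎)
  where open ≤-Reasoning

module _ {n : ℕ} {D : Digraph n} {T : List (Fin n × Fin n)} {r : Fin n}
         (tree-arc : ∀ {p x} → TArc T r p x → Arc D p x) (unique : UniqueDepths {T = T} {r}) where

  no-backward-arc-in-window : ∀ {g} → HasGirth D g → ∀ h u v →
                              W T r g h u → W T r g h v → Arc D u v → ¬ Descendant T r u v
  no-backward-arc-in-window {g} (_ , shortest) h u v (i , i+2≤g , du) (j , _ , dv) back p =
    <-irrefl refl (≤-trans (subst (_≤ g) (+-comm i 2) i+2≤g) (≤-trans g≤1+m (s≤s m≤i)))
    where
      cycle : Cycle D (steps p)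
      cycle = cycle-from-closed-walk D tree-arc p (tree-path-injective unique dv p) back
      g≤1+m : g ≤ suc (steps p)
      g≤1+m = shortest (steps p) cycle
      m≤i : steps p ≤ i
      m≤i = m+[h+j]≡h+i⇒m≤i (steps p) h i j (unique (depth-at-end dv p) du)

module _ {n : ℕ} (D : Digraph n) (r : Fin n) where

  record TreeInvariant (vis : List (Fin n)) (T : List (Fin n × Fin n)) : Set where
    field
      root-visited    : r ∈ vis
      child-visited   : ∀ {p x} → TArc T r p x → x ∈ vis
      root-parentless : ∀ {p x} → TArc T r p x → x ≢ r
      parent-unique   : ∀ {p q x} → TArc T r p x → TArc T r q x → p ≡ q
      tree-arc        : ∀ {p x} → TArc T r p x → Arc D p x

  record StackInvariant (s vis : List (Fin n)) (T : List (Fin n × Fin n)) : Set where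
    field
      finished          : List (Fin n)
      finish-time       : Fin n → ℕ
      visited-split     : ∀ {x} → x ∈ vis → x ∈ s ⊎ x ∈ finished
      stack-visited     : ∀ {x} → x ∈ s → x ∈ vis
      finished-visited  : ∀ {x} → x ∈ finished → x ∈ vis
      stack-unfinished  : ∀ {x} → x ∈ s → x ∉ finished
      stack-unique      : Unique s
      stack-descends    : AllPairs (Descendant T r) s
      finished-arc      : ∀ {f w} → f ∈ finished → Arc D f w →
                          (w ∈ finished × finish-time w < finish-time f) ⊎ Descendant T r f w
      finish-time-bound : ∀ {f} → f ∈ finished → finish-time f < length finished

  push-tree : ∀ {u v vis T} → Arc D u v → v ∉ vis →
              TreeInvariant vis T → TreeInvariant (v ∷ vis) ((u , v) ∷ T)
  push-tree {v = v} {vis} uv v∉vis I = record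
    { root-visited    = there root-visited
    ; child-visited   = λ { (here refl) → here refl ; (there x) → there (child-visited x) }
    ; root-parentless = λ { (here refl) v≡r → v∉vis (subst (_∈ vis) (sym v≡r) root-visited)
                          ; (there x) → root-parentless x }
    ; parent-unique   = λ { (here refl) (here refl) → refl
                          ; (here refl) (there y)   → ⊥-elim (v∉vis (child-visited y))
                          ; (there x)   (here refl) → ⊥-elim (v∉vis (child-visited x))
                          ; (there x)   (there y)   → parent-unique x y }
    ; tree-arc        = λ { (here refl) → uv ; (there x) → tree-arc x }
    }
    where open TreeInvariant I

  push-stack : ∀ {u s v vis T} → v ∉ vis →
               StackInvariant (u ∷ s) vis T → StackInvariant (v ∷ u ∷ s) (v ∷ vis) ((u , v) ∷ T)
  push-stack {u} {s} {v} {vis} {T} v∉vis I = record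
    { finished          = finished
    ; finish-time       = finish-time
    ; visited-split     = λ { (here refl) → inj₁ (here refl) ; (there x) → Sum.map₁ there (visited-split x) }
    ; stack-visited     = λ { (here refl) → here refl ; (there x) → there (stack-visited x) }
    ; finished-visited  = there ∘ finished-visited
    ; stack-unfinished  = λ { (here refl) → v∉vis ∘ finished-visited ; (there x) → stack-unfinished x }
    ; stack-unique      = All.tabulate (λ x v≡x → v∉vis (subst (_∈ vis) (sym v≡x) (stack-visited x)))
                          ∷ stack-unique
    ; stack-descends    = ((uv ◅ ε) ∷ All.map (_◅◅ uv ◅ ε) (AllPairs.head descends)) ∷ descends
    ; finished-arc      = λ f a → Sum.map₂ (Star.map there) (finished-arc f a)
    ; finish-time-bound = finish-time-bound
    }
    where
      open StackInvariant I
      uv : TArc ((u , v) ∷ T) r u v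
      uv = here refl
      descends : AllPairs (Descendant ((u , v) ∷ T) r) (u ∷ s)
      descends = AllPairs.map (Star.map there) stack-descends

  pop-stack : ∀ {u s vis T} → (∀ w → Arc D u w → w ∈ vis) →
              StackInvariant (u ∷ s) vis T → StackInvariant s vis T
  pop-stack {u} {s} {vis} {T} closed I = record
    { finished          = u ∷ finished
    ; finish-time       = finish-time′
    ; visited-split     = split ∘ visited-split
    ; stack-visited     = stack-visited ∘ there
    ; finished-visited  = λ { (here refl) → stack-visited (here refl) ; (there x) → finished-visited x }
    ; stack-unfinished  = stack-unfinished′
    ; stack-unique      = AllPairs.tail stack-unique
    ; stack-descends    = AllPairs.tail stack-descends
    ; finished-arc      = finished-arc′
    ; finish-time-bound = finish-time-bound′
    }
    where
      open StackInvariant I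
      finish-time′ : Fin n → ℕ
      finish-time′ = updateAt finish-time u (const (length finished))
      finished≢u : ∀ {x} → x ∈ finished → x ≢ u
      finished≢u x refl = stack-unfinished (here refl) x
      time-u : finish-time′ u ≡ length finished
      time-u = updateAt-updates u finish-time
      time-old : ∀ {x} → x ∈ finished → finish-time′ x ≡ finish-time x
      time-old x = updateAt-minimal _ u finish-time (finished≢u x)
      split : ∀ {x} → x ∈ u ∷ s ⊎ x ∈ finished → x ∈ s ⊎ x ∈ u ∷ finished
      split (inj₁ (here refl)) = inj₂ (here refl)
      split (inj₁ (there x))   = inj₁ x
      split (inj₂ x)           = inj₂ (there x)
      stack-unfinished′ : ∀ {x} → x ∈ s → x ∉ u ∷ finished
      stack-unfinished′ x (here refl) = All.lookup (AllPairs.head stack-unique) x refl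
      stack-unfinished′ x (there y)   = stack-unfinished (there x) y
      finished-arc′ : ∀ {f w} → f ∈ u ∷ finished → Arc D f w →
                      (w ∈ u ∷ finished × finish-time′ w < finish-time′ f) ⊎ Descendant T r f w
      finished-arc′ {w = w} (here refl) a with visited-split (closed w a)
      ... | inj₁ (here refl) = ⊥-elim (loopless D u a)
      ... | inj₁ (there x)   = inj₂ (All.lookup (AllPairs.head stack-descends) x)
      ... | inj₂ x           =
        inj₁ (there x , subst₂ _<_ (sym (time-old x)) (sym time-u) (finish-time-bound x))
      finished-arc′ (there f) a with finished-arc f a
      ... | inj₁ (x , lt) = inj₁ (there x , subst₂ _<_ (sym (time-old x)) (sym (time-old f)) lt)
      ... | inj₂ d        = inj₂ d
      finish-time-bound′ : ∀ {f} → f ∈ u ∷ finished → finish-time′ f < length (u ∷ finished)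
      finish-time-bound′ (here refl) = subst (_< suc (length finished)) (sym time-u) ≤-refl
      finish-time-bound′ (there x)   =
        subst (_< suc (length finished)) (sym (time-old x)) (m<n⇒m<1+n (finish-time-bound x))

  DFSInvariant : DFSState D → Set
  DFSInvariant ⟨ s , vis , T ⟩ = TreeInvariant vis T × StackInvariant s vis T

  initial-invariant : DFSInvariant ⟨ r ∷ [] , r ∷ [] , [] ⟩
  initial-invariant = tree , stack
    where
      tree : TreeInvariant (r ∷ []) []
      tree = record
        { root-visited = here refl ; child-visited = λ () ; root-parentless = λ ()
        ; parent-unique = λ () ; tree-arc = λ () }
      stack : StackInvariant (r ∷ []) (r ∷ []) []
      stack = record
        { finished = [] ; finish-time = const 0 ; visited-split = inj₁ ; stack-visited = λ x → x
        ; finished-visited = λ () ; stack-unfinished = λ _ () ; stack-unique = All.[] ∷ AllPairs.[]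
        ; stack-descends = All.[] ∷ AllPairs.[] ; finished-arc = λ () ; finish-time-bound = λ () }

  step-preserves : ∀ {st st′} → DFSStep D st st′ → DFSInvariant st → DFSInvariant st′
  step-preserves (push uv v∉vis) (tree , stack) = push-tree uv v∉vis tree , push-stack v∉vis stack
  step-preserves (pop closed)    (tree , stack) = tree , pop-stack closed stack

  run-preserves : ∀ {st st′} → Star (DFSStep D) st st′ → DFSInvariant st → DFSInvariant st′
  run-preserves ε         = λ inv → inv
  run-preserves (x ◅ run) = run-preserves run ∘ step-preserves x

  record DFSTreeProperties (T : List (Fin n × Fin n)) : Set where
    field
      tree-arc      : ∀ {p x} → TArc T r p x → Arc D p x
      unique-depths : UniqueDepths {T = T} {r}
      finish-time   : Fin n → ℕ
      finishes-earlier-or-backward : ∀ {u i w} → Depth T r u i → Arc D u w →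
                                     finish-time w < finish-time u ⊎ Descendant T r u w

  dfs-tree-properties : ∀ {T} → IsDFSTree D r T → DFSTreeProperties T
  dfs-tree-properties {T} (vis , run) = record
    { tree-arc      = tree-arc
    ; unique-depths = depth-unique root-parentless parent-unique
    ; finish-time   = finish-time
    ; finishes-earlier-or-backward = λ d a → Sum.map₁ proj₂ (finished-arc (depth-finished d) a)
    }
    where
      invariant : DFSInvariant ⟨ [] , vis , T ⟩
      invariant = run-preserves run initial-invariant
      open TreeInvariant (proj₁ invariant)
      open StackInvariant (proj₂ invariant)
      depth-visited : ∀ {u i} → Depth T r u i → u ∈ vis
      depth-visited root        = root-visited
      depth-visited (child x _) = child-visited x
      depth-finished : ∀ {u i} → Depth T r u i → u ∈ finished
      depth-finished d with visited-split (depth-visited d)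
      ... | inj₁ ()
      ... | inj₂ x  = x

lemma6 : ∀ {n : ℕ} (D : Digraph n) (g : ℕ) (r : Fin n) (T : List (Fin n × Fin n)) (t : ℕ) →
         StronglyConnected D → HasGirth D g → IsDFSTree D r T → HasLength T r t →
         ∀ (h : ℕ) → h + g ≤ t + 2 →
         InducedAcyclic D (W T r g h)
         × (∀ u v → W T r g h u → W T r g h v → Arc D u v → ¬ Descendant T r u v)
lemma6 D g r T t _ girth dfs _ h _ = acyclic , no-backward
  where
    open DFSTreeProperties (dfs-tree-properties D r dfs)
    no-backward : ∀ u v → W T r g h u → W T r g h v → Arc D u v → ¬ Descendant T r u v
    no-backward = no-backward-arc-in-window tree-arc unique-depths girth h
    finish-time-decreases : ∀ {a b} → W T r g h a → W T r g h b → Arc D a b → finish-time b < finish-time a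
    finish-time-decreases {a} {b} wa@(_ , _ , da) wb ab with finishes-earlier-or-backward da ab
    ... | inj₁ earlier  = earlier
    ... | inj₂ backward = ⊥-elim (no-backward a b wa wb ab backward)
    acyclic : InducedAcyclic D (W T r g h)
    acyclic = acyclic-if-potential-decreases D (W T r g h) finish-time finish-time-decreases
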